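{- Let $G\in\mathfrak{F}$ be a $\delta$-regular finite simple graph of order $n$, and let $K_2$ be the complete graph on two vertices. Then $$\frac{2n}{\delta+1}\le \gamma_R(G\Box K_2)\le \frac{4n}{\delta+1}.$$
   Context: $\gamma(X)$ denotes the domination number of a graph $X$ (minimum size of a set $D$ such that every vertex outside $D$ has a neighbor in $D$). A Roman dominating function on $X$ is a map $f:V(X)\to\{0,1,2\}$ such that every vertex $v$ with $f(v)=0$ has a neighbor $u$ with $f(u)=2$; $\gamma_R(X)$ is the minimum of $\sum_v f(v)$ over such $f$. $\mathfrak{F}$ is the class of graphs $G$ having a dominating set $S=\{u_1,\dots,u_{\gamma(G)}\}$ of size $\gamma(G)$ with $N[u_i]\cap N[u_j]=\emptyset$ for all $i\ne j$, where $N[u]$ is the closed neighborhood of $u$. The Cartesian product $G\Box H$ has vertex set $V(G)\times V(H)$, with $(g,h)\sim(g',h')$ iff ($g=g'$ and $h\sim h'$) or ($g\sim g'$ and $h=h'$). -}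

module Defs where

open import Data.Nat using (ℕ; zero; suc; _+_; _*_; _≤_)
open import Data.Bool using (Bool; true; false; T; not; _∧_; _∨_)
open import Data.Fin using (Fin; zero; suc; toℕ; remQuot; _≟_)
open import Data.Fin.Subset using (Subset; _∈_; _∉_; ∣_∣)
open import Data.Vec using (tabulate)
open import Data.Product using (Σ; _×_; _,_; ∃; ∃-syntax)
open import Relation.Nullary using (¬_; does)
open import Relation.Binary.PropositionalEquality using (_≡_; _≢_)

record Graph (n : ℕ) : Set where
  field
    adj : Fin n → Fin n → Bool
open Graph public

Adj : ∀ {n} → Graph n → Fin n → Fin n → Set
Adj G u v = T (adj G u v)

IsSimple : ∀ {n} → Graph n → Set
IsSimple G = (∀ u v → adj G u v ≡ adj G v u) × (∀ v → adj G v v ≡ false)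

nbhd : ∀ {n} → Graph n → Fin n → Subset n
nbhd G v = tabulate (λ u → adj G v u)

degree : ∀ {n} → Graph n → Fin n → ℕ
degree G v = ∣ nbhd G v ∣

IsRegular : ∀ {n} → Graph n → ℕ → Set
IsRegular G δ = ∀ v → degree G v ≡ δ

InClosedNbhd : ∀ {n} → Graph n → Fin n → Fin n → Set
InClosedNbhd G u w = (w ≡ u) Data.Sum.⊎ Adj G u w
  where import Data.Sum

IsDominating : ∀ {n} → Graph n → Subset n → Set
IsDominating G D = ∀ v → v ∉ D → ∃[ u ] (u ∈ D × Adj G u v)

IsMinDominating : ∀ {n} → Graph n → Subset n → Set
IsMinDominating G S = IsDominating G S × (∀ D → IsDominating G D → ∣ S ∣ ≤ ∣ D ∣)

IsDominationNumber : ∀ {n} → Graph n → ℕ → Set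
IsDominationNumber G k = Σ (Subset _) λ S → IsMinDominating G S × ∣ S ∣ ≡ k

InClassF : ∀ {n} → Graph n → Set
InClassF G = Σ (Subset _) λ S → IsMinDominating G S ×
  (∀ u v → u ∈ S → v ∈ S → u ≢ v → ∀ w → ¬ (InClosedNbhd G u w × InClosedNbhd G v w))

sumFin : ∀ {n} → (Fin n → ℕ) → ℕ
sumFin {zero} f = 0
sumFin {suc n} f = f zero + sumFin (λ i → f (suc i))

IsRDF : ∀ {n} → Graph n → (Fin n → Fin 3) → Set
IsRDF G f = ∀ v → f v ≡ zero → ∃[ u ] (f u ≡ suc (suc zero) × Adj G u v)

weight : ∀ {n} → (Fin n → Fin 3) → ℕ
weight f = sumFin (λ v → toℕ (f v))

IsRomanDominationNumber : ∀ {n} → Graph n → ℕ → Set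
IsRomanDominationNumber G k =
  (Σ _ λ f → IsRDF G f × weight f ≡ k) × (∀ f → IsRDF G f → k ≤ weight f)

K₂ : Graph 2
K₂ = record { adj = λ i j → not (does (i ≟ j)) }

-- Cartesian product; vertex x of Fin (m * k) is identified with remQuot k x : Fin m × Fin k
_□_ : ∀ {m k} → Graph m → Graph k → Graph (m * k)
_□_ {m} {k} G H = record { adj = λ x y → go (remQuot k x) (remQuot k y) }
  where
  go : Fin m × Fin k → Fin m × Fin k → Bool
  go (g , i) (h , j) = (does (g ≟ h) ∧ adj H i j) ∨ (adj G g h ∧ does (i ≟ j))

-- G □ K₂ is (δ+1)-regular on 2n vertices. Under a Roman dominating function every vertex has a
-- positive label or a neighbour labelled 2, so 2n ≤ |V₁| + |V₂| + (δ+1)|V₂| ≤ (δ+1)(|V₁| + 2|V₂|).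
-- Conversely, the closed neighbourhoods of a dominating set S of G with pairwise disjoint closed
-- neighbourhoods are |S| disjoint sets of size δ+1, so |S|(δ+1) ≤ n, while labelling both copies of S
-- by 2 is a Roman dominating function of G □ K₂ of weight 4|S|.
module Submission where

open import Defs
open import Data.Nat using (ℕ; zero; suc; _+_; _*_; _≤_; z≤n; s≤s)
open import Data.Nat.Properties
  using (+-*-semiring; ≤-refl; ≤-trans; ≤-reflexive; +-mono-≤; *-monoˡ-≤; *-monoʳ-≤;
         m≤m+n; m≤n+m; +-assoc; +-comm; +-identityʳ; *-identityˡ; *-identityʳ; *-zeroʳ; *-comm; *-assoc; module ≤-Reasoning)
open import Data.Bool using (Bool; true; false; T; _∧_; _∨_; if_then_else_)
open import Data.Bool.Properties using (T-≡; T-∧; T-∨; ∧-comm)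
open import Data.Fin using (Fin; zero; suc; toℕ; remQuot; quotRem; quotient; combine; _≟_; _↑ˡ_; _↑ʳ_)
open import Data.Fin.Patterns using (0F; 1F; 2F)
open import Data.Fin.Properties using (remQuot-combine; combine-remQuot; suc-injective; 0≢1+n)
open import Data.Fin.Subset using (Subset; _∈_; ∣_∣; inside; outside)
open import Data.Vec using ([]; _∷_; lookup)
open import Data.Vec.Properties using (lookup∘tabulate; lookup⇒[]=; []=⇒lookup)
open import Data.Product using (∃-syntax; _×_; _,_; proj₁; proj₂; swap)
open import Data.Sum using (inj₁; inj₂)
open import Data.Empty using (⊥-elim)
open import Data.Unit using (tt)
open import Function using (_∘_; case_of_; Equivalence)
open import Relation.Nullary using (¬_; does; yes; no)
open import Relation.Nullary.Decidable using (dec-true)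
open import Relation.Binary.PropositionalEquality
open import Algebra.Properties.Semiring.Sum +-*-semiring
  using (sum; sum-syntax; sum-cong-≗; ∑-distrib-+; ∑-comm; *-distribˡ-sum; *-distribʳ-sum)

𝟙 : Bool → ℕ
𝟙 true = 1
𝟙 false = 0

sumFin≡sum : ∀ {n} (f : Fin n → ℕ) → sumFin f ≡ sum f
sumFin≡sum {zero} f = refl
sumFin≡sum {suc n} f = cong (f zero +_) (sumFin≡sum (f ∘ suc))

sum-mono-≤ : ∀ {n} {f g : Fin n → ℕ} → (∀ i → f i ≤ g i) → sum f ≤ sum g
sum-mono-≤ {zero} f≤g = z≤n
sum-mono-≤ {suc n} f≤g = +-mono-≤ (f≤g zero) (sum-mono-≤ (f≤g ∘ suc))

term≤sum : ∀ {n} (f : Fin n → ℕ) i → f i ≤ sum f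
term≤sum f zero = m≤m+n (f zero) _
term≤sum f (suc i) = ≤-trans (term≤sum (f ∘ suc) i) (m≤n+m _ (f zero))

sum-const : ∀ n c → ∑[ i < n ] c ≡ n * c
sum-const zero c = refl
sum-const (suc n) c = cong (c +_) (sum-const n c)

sum-↑ : ∀ a b (f : Fin (a + b) → ℕ) → sum f ≡ ∑[ i < a ] f (i ↑ˡ b) + ∑[ j < b ] f (a ↑ʳ j)
sum-↑ zero b f = refl
sum-↑ (suc a) b f = trans (cong (f zero +_) (sum-↑ a b (f ∘ suc))) (sym (+-assoc (f zero) _ _))

sum-combine : ∀ m k (f : Fin (m * k) → ℕ) → sum f ≡ ∑[ g < m ] ∑[ i < k ] f (combine g i)
sum-combine zero k f = refl
sum-combine (suc m) k f =
  trans (sum-↑ k (m * k) f) (cong (sum (f ∘ (_↑ˡ m * k)) +_) (sum-combine m k (f ∘ (k ↑ʳ_))))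

∑-δ : ∀ {n} (i : Fin n) (c : Fin n → ℕ) → ∑[ j < n ] (𝟙 (does (i ≟ j)) * c j) ≡ c i
∑-δ {suc n} zero c = begin
  c zero + 0 + ∑[ j < n ] 0 ≡⟨ cong (c zero + 0 +_) (trans (sum-const n 0) (*-zeroʳ n)) ⟩
  c zero + 0 + 0            ≡⟨ trans (+-identityʳ _) (+-identityʳ _) ⟩
  c zero                    ∎
  where open ≡-Reasoning
∑-δ {suc n} (suc i) c = ∑-δ i (c ∘ suc)

T⇒𝟙≡1 : ∀ {x} → T x → 𝟙 x ≡ 1
T⇒𝟙≡1 {true} _ = refl

𝟙-∧ : ∀ x y → 𝟙 (x ∧ y) ≡ 𝟙 x * 𝟙 y
𝟙-∧ true y = sym (+-identityʳ (𝟙 y))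
𝟙-∧ false y = refl

∑𝟙-δ∧ : ∀ {n} (i : Fin n) (b : Fin n → Bool) → ∑[ j < n ] 𝟙 (does (i ≟ j) ∧ b j) ≡ 𝟙 (b i)
∑𝟙-δ∧ i b = trans (sum-cong-≗ (λ j → 𝟙-∧ (does (i ≟ j)) (b j))) (∑-δ i (𝟙 ∘ b))

𝟙-∨ : ∀ x y → ¬ (T x × T y) → 𝟙 (x ∨ y) ≡ 𝟙 x + 𝟙 y
𝟙-∨ true true exclusive = ⊥-elim (exclusive (tt , tt))
𝟙-∨ true false _ = refl
𝟙-∨ false y _ = refl

∑𝟙-unique : ∀ {n} (b : Fin n → Bool) → (∀ i j → T (b i) → T (b j) → i ≡ j) → ∑[ i < n ] 𝟙 (b i) ≤ 1
∑𝟙-unique {zero} b unique = z≤n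
∑𝟙-unique {suc n} b unique with b zero in b₀
... | false = ∑𝟙-unique (b ∘ suc) (λ i j p q → suc-injective (unique (suc i) (suc j) p q))
... | true = s≤s (≤-reflexive (∑𝟙-none (b ∘ suc) λ i p → 0≢1+n (unique zero (suc i) b₀-holds p)))
  where
  b₀-holds : T (b zero)
  b₀-holds = Equivalence.from T-≡ b₀
  ∑𝟙-none : ∀ {m} (c : Fin m → Bool) → (∀ i → ¬ T (c i)) → ∑[ i < m ] 𝟙 (c i) ≡ 0
  ∑𝟙-none {zero} c none = refl
  ∑𝟙-none {suc m} c none with c zero in c₀
  ... | true = ⊥-elim (none zero (Equivalence.from T-≡ c₀))
  ... | false = ∑𝟙-none (c ∘ suc) (none ∘ suc)

∣p∣≡∑𝟙 : ∀ {n} (p : Subset n) → ∣ p ∣ ≡ ∑[ i < n ] 𝟙 (lookup p i)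
∣p∣≡∑𝟙 [] = refl
∣p∣≡∑𝟙 (outside ∷ p) = ∣p∣≡∑𝟙 p
∣p∣≡∑𝟙 (inside ∷ p) = cong suc (∣p∣≡∑𝟙 p)

degree≡∑𝟙 : ∀ {n} (G : Graph n) v → degree G v ≡ ∑[ u < n ] 𝟙 (adj G v u)
degree≡∑𝟙 G v = trans (∣p∣≡∑𝟙 (nbhd G v)) (sum-cong-≗ (cong 𝟙 ∘ lookup∘tabulate (adj G v)))

Irreflexive : ∀ {n} → Graph n → Set
Irreflexive G = ∀ v → adj G v v ≡ false

∀-combine : ∀ {m} k {P : Fin (m * k) → Set} → (∀ g i → P (combine g i)) → ∀ x → P x
∀-combine {m} k {P} P-combine x =
  subst P (combine-remQuot {m} k x) (P-combine (proj₁ (remQuot {m} k x)) (proj₂ (remQuot {m} k x)))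

-- `remQuot` unfolds to `swap ∘ quotRem` in `_□_`, so rewriting has to happen at `quotRem`.
quotRem-combine : ∀ {m k} (g : Fin m) (i : Fin k) → quotRem k (combine g i) ≡ (i , g)
quotRem-combine g i = cong swap (remQuot-combine g i)

adj-□ : ∀ {m k} (G : Graph m) (H : Graph k) g i h j →
  adj (G □ H) (combine g i) (combine h j) ≡ (does (g ≟ h) ∧ adj H i j) ∨ (adj G g h ∧ does (i ≟ j))
adj-□ G H g i h j rewrite quotRem-combine g i | quotRem-combine h j = refl

degree-□ : ∀ {m k} (G : Graph m) (H : Graph k) → Irreflexive G →
  ∀ g i → degree (G □ H) (combine g i) ≡ degree G g + degree H i
degree-□ {m} {k} G H irreflexive g i = begin
  degree (G □ H) (combine g i)
    ≡⟨ trans (degree≡∑𝟙 (G □ H) _) (sum-combine m k _) ⟩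
  ∑[ h < m ] ∑[ j < k ] 𝟙 (adj (G □ H) (combine g i) (combine h j))
    ≡⟨ sum-cong-≗ (λ h → sum-cong-≗ (λ j → trans (cong 𝟙 (adj-□ G H g i h j)) (𝟙-∨ _ _ (exclusive h j)))) ⟩
  ∑[ h < m ] ∑[ j < k ] (𝟙 (does (g ≟ h) ∧ adj H i j) + 𝟙 (adj G g h ∧ does (i ≟ j)))
    ≡⟨ trans (sum-cong-≗ (λ h → ∑-distrib-+ (λ j → 𝟙 (does (g ≟ h) ∧ adj H i j)) (λ j → 𝟙 (adj G g h ∧ does (i ≟ j)))))
             (∑-distrib-+ (λ h → ∑[ j < k ] 𝟙 (does (g ≟ h) ∧ adj H i j)) (λ h → ∑[ j < k ] 𝟙 (adj G g h ∧ does (i ≟ j)))) ⟩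
  ∑[ h < m ] ∑[ j < k ] 𝟙 (does (g ≟ h) ∧ adj H i j) + ∑[ h < m ] ∑[ j < k ] 𝟙 (adj G g h ∧ does (i ≟ j))
    ≡⟨ cong₂ _+_ (∑-comm (λ h j → 𝟙 (does (g ≟ h) ∧ adj H i j))) (sum-cong-≗ (λ h → sum-cong-≗ (λ j → cong 𝟙 (∧-comm (adj G g h) (does (i ≟ j)))))) ⟩
  ∑[ j < k ] ∑[ h < m ] 𝟙 (does (g ≟ h) ∧ adj H i j) + ∑[ h < m ] ∑[ j < k ] 𝟙 (does (i ≟ j) ∧ adj G g h)
    ≡⟨ cong₂ _+_ (sum-cong-≗ (λ j → ∑𝟙-δ∧ g (λ _ → adj H i j))) (sum-cong-≗ (λ h → ∑𝟙-δ∧ i (λ _ → adj G g h))) ⟩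
  ∑[ j < k ] 𝟙 (adj H i j) + ∑[ h < m ] 𝟙 (adj G g h)
    ≡⟨ cong₂ _+_ (sym (degree≡∑𝟙 H i)) (sym (degree≡∑𝟙 G g)) ⟩
  degree H i + degree G g
    ≡⟨ +-comm (degree H i) (degree G g) ⟩
  degree G g + degree H i ∎
  where
  open ≡-Reasoning
  exclusive : ∀ h j → ¬ (T (does (g ≟ h) ∧ adj H i j) × T (adj G g h ∧ does (i ≟ j)))
  exclusive h j (layer , edge) with g ≟ h
  ... | yes refl = subst T (irreflexive g) (proj₁ (Equivalence.to T-∧ edge))

degree-K₂ : ∀ i → degree K₂ i ≡ 1
degree-K₂ 0F = refl
degree-K₂ 1F = refl

□K₂-regular : ∀ {n δ} (G : Graph n) → Irreflexive G → IsRegular G δ → IsRegular (G □ K₂) (suc δ)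
□K₂-regular {n} {δ} G irreflexive regular = ∀-combine {n} 2 {λ v → degree (G □ K₂) v ≡ suc δ} λ g i →
  trans (degree-□ G K₂ irreflexive g i) (trans (cong₂ _+_ (regular g) (degree-K₂ i)) (+-comm δ 1))

positive : Fin 3 → ℕ
positive 0F = 0
positive _ = 1

isTwo : Fin 3 → ℕ
isTwo 2F = 1
isTwo _ = 0

positive+isTwo*suc≤toℕ*suc : ∀ a c → positive a + isTwo a * suc c ≤ toℕ a * suc c
positive+isTwo*suc≤toℕ*suc 0F c = z≤n
positive+isTwo*suc≤toℕ*suc 1F c = s≤s z≤n
positive+isTwo*suc≤toℕ*suc 2F c = s≤s (m≤n+m (suc c + 0) c)

module _ {N} (X : Graph N) (f : Fin N → Fin 3) (roman : IsRDF X f) where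

  rdf-covers : ∀ v → 1 ≤ positive (f v) + ∑[ u < N ] (isTwo (f u) * 𝟙 (adj X u v))
  rdf-covers v with f v in fv
  ... | 1F = s≤s z≤n
  ... | 2F = s≤s z≤n
  ... | 0F with roman v fv
  ... | u , fu , edge = begin
    1                                     ≡⟨ T⇒𝟙≡1 edge ⟨
    𝟙 (adj X u v)                         ≡⟨ *-identityˡ _ ⟨
    isTwo 2F * 𝟙 (adj X u v)              ≡⟨ cong (λ a → isTwo a * 𝟙 (adj X u v)) fu ⟨
    isTwo (f u) * 𝟙 (adj X u v)           ≤⟨ term≤sum (λ u → isTwo (f u) * 𝟙 (adj X u v)) u ⟩
    ∑[ u < N ] (isTwo (f u) * 𝟙 (adj X u v)) ∎
    where open ≤-Reasoning

  rdf-weight-bound : ∀ c → (∀ v → degree X v ≤ suc c) → N ≤ weight f * suc c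
  rdf-weight-bound c bounded = begin
    N
      ≡⟨ trans (sym (*-identityʳ N)) (sym (sum-const N 1)) ⟩
    ∑[ v < N ] 1
      ≤⟨ sum-mono-≤ rdf-covers ⟩
    ∑[ v < N ] (positive (f v) + ∑[ u < N ] (isTwo (f u) * 𝟙 (adj X u v)))
      ≡⟨ ∑-distrib-+ (positive ∘ f) (λ v → ∑[ u < N ] (isTwo (f u) * 𝟙 (adj X u v))) ⟩
    ∑[ v < N ] positive (f v) + ∑[ v < N ] ∑[ u < N ] (isTwo (f u) * 𝟙 (adj X u v))
      ≡⟨ cong (∑[ v < N ] positive (f v) +_) (sym (∑-comm (λ u v → isTwo (f u) * 𝟙 (adj X u v)))) ⟩
    ∑[ u < N ] positive (f u) + ∑[ u < N ] ∑[ v < N ] (isTwo (f u) * 𝟙 (adj X u v))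
      ≡⟨ cong (∑[ u < N ] positive (f u) +_) (sum-cong-≗ λ u →
           trans (sym (*-distribˡ-sum (isTwo (f u)) (𝟙 ∘ adj X u))) (cong (isTwo (f u) *_) (sym (degree≡∑𝟙 X u)))) ⟩
    ∑[ u < N ] positive (f u) + ∑[ u < N ] (isTwo (f u) * degree X u)
      ≤⟨ +-mono-≤ (≤-refl {∑[ u < N ] positive (f u)}) (sum-mono-≤ λ u → *-monoʳ-≤ (isTwo (f u)) (bounded u)) ⟩
    ∑[ u < N ] positive (f u) + ∑[ u < N ] (isTwo (f u) * suc c)
      ≡⟨ sym (∑-distrib-+ (positive ∘ f) (λ u → isTwo (f u) * suc c)) ⟩
    ∑[ u < N ] (positive (f u) + isTwo (f u) * suc c)
      ≤⟨ sum-mono-≤ (λ u → positive+isTwo*suc≤toℕ*suc (f u) c) ⟩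
    ∑[ u < N ] (toℕ (f u) * suc c)
      ≡⟨ sym (*-distribʳ-sum (suc c) (toℕ ∘ f)) ⟩
    sum (toℕ ∘ f) * suc c
      ≡⟨ cong (_* suc c) (sym (sumFin≡sum (toℕ ∘ f))) ⟩
    weight f * suc c ∎
    where open ≤-Reasoning

T⇒∈ : ∀ {n} {S : Subset n} {u} → T (lookup S u) → u ∈ S
T⇒∈ {S = S} {u} t = lookup⇒[]= u S (Equivalence.to T-≡ t)

ClosedNbhdsDisjoint : ∀ {n} → Graph n → Subset n → Set
ClosedNbhdsDisjoint G S =
  ∀ u v → u ∈ S → v ∈ S → u ≢ v → ∀ w → ¬ (InClosedNbhd G u w × InClosedNbhd G v w)

closedNbhd : ∀ {n} → Graph n → Fin n → Fin n → Bool
closedNbhd G u w = does (u ≟ w) ∨ adj G u w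

T-closedNbhd : ∀ {n} (G : Graph n) {u w} → T (closedNbhd G u w) → InClosedNbhd G u w
T-closedNbhd G {u} {w} t with u ≟ w
... | yes u≡w = inj₁ (sym u≡w)
... | no _ = inj₂ t

∑𝟙-closedNbhd : ∀ {n} (G : Graph n) → Irreflexive G → ∀ u → ∑[ w < n ] 𝟙 (closedNbhd G u w) ≡ suc (degree G u)
∑𝟙-closedNbhd {n} G irreflexive u = begin
  ∑[ w < n ] 𝟙 (closedNbhd G u w)
    ≡⟨ sum-cong-≗ (λ w → 𝟙-∨ (does (u ≟ w)) (adj G u w) (exclusive w)) ⟩
  ∑[ w < n ] (𝟙 (does (u ≟ w)) + 𝟙 (adj G u w))
    ≡⟨ ∑-distrib-+ (λ w → 𝟙 (does (u ≟ w))) (𝟙 ∘ adj G u) ⟩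
  ∑[ w < n ] 𝟙 (does (u ≟ w)) + ∑[ w < n ] 𝟙 (adj G u w)
    ≡⟨ cong₂ _+_ (trans (sum-cong-≗ (λ w → sym (*-identityʳ (𝟙 (does (u ≟ w)))))) (∑-δ u (λ _ → 1))) (sym (degree≡∑𝟙 G u)) ⟩
  suc (degree G u) ∎
  where
  open ≡-Reasoning
  exclusive : ∀ w → ¬ (T (does (u ≟ w)) × T (adj G u w))
  exclusive w (u≡w , edge) with u ≟ w
  ... | yes refl = subst T (irreflexive u) edge

packing-bound : ∀ {n δ} (G : Graph n) → Irreflexive G → (∀ u → δ ≤ degree G u) →
  (S : Subset n) → ClosedNbhdsDisjoint G S → ∣ S ∣ * suc δ ≤ n
packing-bound {n} {δ} G irreflexive minDegree S disjoint = begin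
  ∣ S ∣ * suc δ
    ≡⟨ trans (cong (_* suc δ) (∣p∣≡∑𝟙 S)) (*-distribʳ-sum (suc δ) (𝟙 ∘ lookup S)) ⟩
  ∑[ u < n ] (𝟙 (lookup S u) * suc δ)
    ≤⟨ sum-mono-≤ (λ u → *-monoʳ-≤ (𝟙 (lookup S u)) (≤-trans (s≤s (minDegree u)) (≤-reflexive (sym (∑𝟙-closedNbhd G irreflexive u))))) ⟩
  ∑[ u < n ] (𝟙 (lookup S u) * ∑[ w < n ] 𝟙 (closedNbhd G u w))
    ≡⟨ sum-cong-≗ (λ u → *-distribˡ-sum (𝟙 (lookup S u)) (𝟙 ∘ closedNbhd G u)) ⟩
  ∑[ u < n ] ∑[ w < n ] (𝟙 (lookup S u) * 𝟙 (closedNbhd G u w))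
    ≡⟨ ∑-comm (λ u w → 𝟙 (lookup S u) * 𝟙 (closedNbhd G u w)) ⟩
  ∑[ w < n ] ∑[ u < n ] (𝟙 (lookup S u) * 𝟙 (closedNbhd G u w))
    ≡⟨ sum-cong-≗ (λ w → sum-cong-≗ (λ u → sym (𝟙-∧ (lookup S u) (closedNbhd G u w)))) ⟩
  ∑[ w < n ] ∑[ u < n ] 𝟙 (lookup S u ∧ closedNbhd G u w)
    ≤⟨ sum-mono-≤ (λ w → ∑𝟙-unique (λ u → lookup S u ∧ closedNbhd G u w) (unique w)) ⟩
  ∑[ w < n ] 1
    ≡⟨ trans (sum-const n 1) (*-identityʳ n) ⟩
  n ∎
  where
  open ≤-Reasoning
  unique : ∀ w u v → T (lookup S u ∧ closedNbhd G u w) → T (lookup S v ∧ closedNbhd G v w) → u ≡ v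
  unique w u v p q with u ≟ v | Equivalence.to T-∧ p | Equivalence.to T-∧ q
  ... | yes u≡v | _ | _ = u≡v
  ... | no u≢v | u∈S , wu | v∈S , wv =
    ⊥-elim (disjoint u v (T⇒∈ u∈S) (T⇒∈ v∈S) u≢v w (T-closedNbhd G wu , T-closedNbhd G wv))

twoOn : ∀ {n} → Subset n → Fin n → Fin 3
twoOn S g = if lookup S g then 2F else 0F

toℕ-twoOn : ∀ {n} (S : Subset n) g → toℕ (twoOn S g) ≡ 2 * 𝟙 (lookup S g)
toℕ-twoOn S g with lookup S g
... | true = refl
... | false = refl

twoAbove : ∀ {n} k → Subset n → Fin (n * k) → Fin 3
twoAbove {n} k S x = twoOn S (quotient {n} k x)

twoAbove-combine : ∀ {n k} (S : Subset n) g (i : Fin k) → twoAbove k S (combine g i) ≡ twoOn S g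
twoAbove-combine S g i = cong (twoOn S ∘ proj₁) (remQuot-combine g i)

twoAbove-isRDF : ∀ {n k} (G : Graph n) (H : Graph k) (S : Subset n) → IsDominating G S →
  IsRDF (G □ H) (twoAbove k S)
twoAbove-isRDF {n} {k} G H S dominating = ∀-combine {n} k {P} covered
  where
  P : Fin (n * k) → Set
  P x = twoAbove k S x ≡ 0F → ∃[ y ] (twoAbove k S y ≡ 2F × Adj (G □ H) y x)
  covered : ∀ g i → P (combine g i)
  covered g i zero-at with lookup S g in Sg | trans (sym (twoAbove-combine S g i)) zero-at
  ... | false | _ with dominating g (λ g∈S → case trans (sym ([]=⇒lookup g∈S)) Sg of λ ())
  ... | u , u∈S , edge = combine u i , dominator-two , dominator-adjacent
    where
    dominator-two : twoAbove k S (combine u i) ≡ 2F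
    dominator-two = trans (twoAbove-combine S u i) (cong (λ b → if b then 2F else 0F) ([]=⇒lookup u∈S))
    dominator-adjacent : Adj (G □ H) (combine u i) (combine g i)
    dominator-adjacent = subst T (sym (adj-□ G H u i g i))
      (Equivalence.from T-∨ (inj₂ (Equivalence.from T-∧ (edge , Equivalence.from T-≡ (dec-true (i ≟ i) refl)))))

weight-twoAbove : ∀ {n} k (S : Subset n) → weight (twoAbove k S) ≡ 2 * k * ∣ S ∣
weight-twoAbove {n} k S = begin
  weight (twoAbove k S)
    ≡⟨ trans (sumFin≡sum (toℕ ∘ twoAbove k S)) (sum-combine n k (toℕ ∘ twoAbove k S)) ⟩
  ∑[ g < n ] ∑[ i < k ] toℕ (twoAbove k S (combine g i))
    ≡⟨ sum-cong-≗ (λ g → sum-cong-≗ (λ i → cong toℕ (twoAbove-combine {n} {k} S g i))) ⟩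
  ∑[ g < n ] ∑[ i < k ] toℕ (twoOn S g)
    ≡⟨ sum-cong-≗ (λ g → trans (sum-const k (toℕ (twoOn S g))) (cong (k *_) (toℕ-twoOn S g))) ⟩
  ∑[ g < n ] (k * (2 * 𝟙 (lookup S g)))
    ≡⟨ sum-cong-≗ (λ g → trans (sym (*-assoc k 2 _)) (cong (_* 𝟙 (lookup S g)) (*-comm k 2))) ⟩
  ∑[ g < n ] (2 * k * 𝟙 (lookup S g))
    ≡⟨ sym (*-distribˡ-sum (2 * k) (𝟙 ∘ lookup S)) ⟩
  2 * k * ∑[ g < n ] 𝟙 (lookup S g)
    ≡⟨ cong (2 * k *_) (sym (∣p∣≡∑𝟙 S)) ⟩
  2 * k * ∣ S ∣ ∎
  where open ≡-Reasoning

proposition19 : (n δ : ℕ) (G : Graph n) → IsSimple G → IsRegular G δ → InClassF G →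
    (r : ℕ) → IsRomanDominationNumber (G □ K₂) r →
    (2 * n ≤ r * suc δ) × (r * suc δ ≤ 4 * n)
proposition19 n δ G (_ , irreflexive) regular (S , (dominating , _) , disjoint) _
  ((f , roman , refl) , minimal) = lower , upper
  where
  lower : 2 * n ≤ weight f * suc δ
  lower = subst (_≤ weight f * suc δ) (*-comm n 2)
    (rdf-weight-bound (G □ K₂) f roman δ (≤-reflexive ∘ □K₂-regular G irreflexive regular))
  upper : weight f * suc δ ≤ 4 * n
  upper = begin
    weight f * suc δ             ≤⟨ *-monoˡ-≤ (suc δ) (minimal _ (twoAbove-isRDF G K₂ S dominating)) ⟩
    weight (twoAbove 2 S) * suc δ ≡⟨ cong (_* suc δ) (weight-twoAbove 2 S) ⟩
    4 * ∣ S ∣ * suc δ             ≡⟨ *-assoc 4 ∣ S ∣ (suc δ) ⟩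
    4 * (∣ S ∣ * suc δ)           ≤⟨ *-monoʳ-≤ 4 (packing-bound G irreflexive (≤-reflexive ∘ sym ∘ regular) S disjoint) ⟩
    4 * n                         ∎
    where open ≤-Reasoning
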